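{- Let $F$ be a figure which admits a domino tiling, with an equilibrium function $eq$ and associated set $\mathcal{H}_F$ of height functions, and let $h_{\min}$ and $h_{\max}$ be the minimum and maximum of $(\mathcal{H}_F,\le)$. For every forced component $U\neq U_\infty$ one has $h_{\min}(v_U)\neq h_{\max}(v_U)$, where $v_U$ is any vertex of $U$.
   Context: Square grid $\Lambda$ with vertices $\mathbb{Z}^2$, unit edges, unit square cells coloured black/white as a checkerboard. A figure $F$ is a finite 4-connected union of cells. $H_\infty$ is the unbounded 8-connected component of $\mathbb{R}^2\setminus F$. Every vertex all of whose incident edges lie on the boundary of $F$ (two cells of $F$ meeting only at that corner) is replaced by two copies, each adjacent to the two neighbours lying on one of these cells. $G_F=(V_F,E_F)$: vertices are corners of cells of $F$ (after duplication), arcs are both orientations of each side of each cell of $F$; $E_b(F)$: arcs whose edge lies on the boundary of $F$; others interior. For $g:E_F\to\mathbb{Z}$ and a path $P$, $g(P)$ is the sum of $g$ over arcs of $P$; $D(h)(v,v')=h(v')-h(v)$. Spin: $sp(v,v')=1$ if moving from $v$ to $v'$ there is a white cell on the left, $-1$ otherwise. $Dis_F(C)$ for an elementary clockwise cycle: black minus white cells of $F$ enclosed. An equilibrium function is a skew-symmetric $eq:E_F\to\mathbb{Z}$ with $sp(C)+eq(C)=4Dis_F(C)$ for all elementary clockwise cycles $C$. $\mathbf{t}(a)=eq(a)-sp(a)+2$, $\mathbf{b}(a)=eq(a)-sp(a)-2$ for interior arcs, $\mathbf{t}(a)=\mathbf{b}(a)=eq(a)+sp(a)$ on $E_b(F)$.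 Fix $w_0\in V_F$ on the boundary of $H_\infty$; $\mathcal{H}_F$ is the set of $h:V_F\to\mathbb{Z}$ with $h(w_0)=0$ and $D(h)(a)\in\{\mathbf{b}(a),\mathbf{t}(a)\}$ for all $a$, ordered pointwise (it is a finite nonempty lattice when $F$ is tileable). An elementary cycle $C$ is critical if $\mathbf{t}(C)=0$. Forced components are the classes of the equivalence relation on $V_F$ under which vertices lying on a common critical cycle are equivalent; $U_\infty$ is the forced component containing $w_0$. -}

module Defs where

open import Data.Bool using (Bool; true; false; _∧_; _∨_; not; if_then_else_)
open import Data.Nat as ℕ using (ℕ)
open import Data.Nat.DivMod using (_%_)
open import Data.Integer as ℤ using (ℤ; +_; -_; _+_; _-_; _*_; _<_; _≤_; ∣_∣)
open import Data.Product using (Σ; _×_; _,_; proj₁; proj₂)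
open import Data.Product.Properties using (≡-dec)
open import Data.Sum using (_⊎_)
open import Data.Empty using (⊥)
open import Data.List using (List; []; _∷_; map; foldr; length; concatMap)
open import Data.Bool.ListAction using (any)
open import Data.List.Membership.Propositional using (_∈_; _∉_)
open import Data.List.Relation.Unary.All using (All)
open import Data.List.Relation.Unary.Unique.Propositional using (Unique)
open import Data.List.Relation.Binary.Permutation.Propositional using (_↭_)
open import Relation.Binary.PropositionalEquality using (_≡_; _≢_)
open import Relation.Binary.Definitions using (DecidableEquality)
open import Relation.Binary.Construct.Closure.ReflexiveTransitive using (Star)
open import Relation.Nullary using (does)

-- Lattice points and cells.  A cell is named by its lower-left corner.

Point : Set
Point = ℤ × ℤ

Cell : Set
Cell = ℤ × ℤ

_≟p_ : DecidableEquality (ℤ × ℤ)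
_≟p_ = ≡-dec ℤ._≟_ ℤ._≟_

inF : List Cell → Cell → Bool
inF F c = any (λ d → does (c ≟p d)) F

isBlack : Cell → Bool
isBlack (x , y) = does ((∣ x + y ∣ % 2) ℕ.≟ 0)

colour : Cell → ℤ
colour c = if isBlack c then + 1 else - (+ 1)

data Dir : Set where
  E N W S : Dir

opp : Dir → Dir
opp E = W
opp N = S
opp W = E
opp S = N

step : Point → Dir → Point
step (x , y) E = (x + + 1 , y)
step (x , y) N = (x , y + + 1)
step (x , y) W = (x - + 1 , y)
step (x , y) S = (x , y - + 1)

Arc : Set
Arc = Point × Dir

headP : Arc → Point
headP (p , d) = step p d

rev : Arc → Arc
rev (p , d) = (step p d , opp d)

leftCell : Arc → Cell
leftCell ((x , y) , E) = (x , y)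
leftCell ((x , y) , N) = (x - + 1 , y)
leftCell ((x , y) , W) = (x - + 1 , y - + 1)
leftCell ((x , y) , S) = (x , y - + 1)

rightCell : Arc → Cell
rightCell ((x , y) , E) = (x , y - + 1)
rightCell ((x , y) , N) = (x , y)
rightCell ((x , y) , W) = (x - + 1 , y)
rightCell ((x , y) , S) = (x - + 1 , y - + 1)

sp : Arc → ℤ
sp a = if isBlack (leftCell a) then - (+ 1) else + 1

Adj4 : Cell → Cell → Set
Adj4 c c' = Σ Dir λ d → c' ≡ step c d

Adj4In : List Cell → Cell → Cell → Set
Adj4In F c c' = c ∈ F × c' ∈ F × Adj4 c c'

Figure : List Cell → Set
Figure F = Unique F × (F ≢ []) × (∀ c c' → c ∈ F → c' ∈ F → Star (Adj4In F) c c')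

Tileable : List Cell → Set
Tileable F = Σ (List (Cell × Cell)) λ T →
  All (λ dm → Adj4 (proj₁ dm) (proj₂ dm)) T ×
  (concatMap (λ dm → proj₁ dm ∷ proj₂ dm ∷ []) T ↭ F)

-- A vertex is a point with a copy flag.  At a "pinch" point (exactly two
-- diagonally opposite incident cells in F) there are two copies:
-- flag true = copy attached to the northern cell, false = southern cell.
-- At any other point only the copy with flag false is used.

pinch : List Cell → Point → Bool
pinch F (x , y) =
  let sw = inF F (x - + 1 , y - + 1)
      se = inF F (x , y - + 1)
      nw = inF F (x - + 1 , y)
      ne = inF F (x , y)
  in (sw ∧ ne ∧ not se ∧ not nw) ∨ (se ∧ nw ∧ not sw ∧ not ne)

Vertex : Set
Vertex = Point × Bool

Corner : Point → Cell → Set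
Corner (px , py) (x , y) = (px ≡ x ⊎ px ≡ x + + 1) × (py ≡ y ⊎ py ≡ y + + 1)

InV : List Cell → Vertex → Set
InV F (p , false) = Σ Cell λ c → c ∈ F × Corner p c
InV F (p , true)  = pinch F p ≡ true

InE : List Cell → Arc → Set
InE F a = (inF F (leftCell a) ∨ inF F (rightCell a)) ≡ true

interior : List Cell → Arc → Bool
interior F a = inF F (leftCell a) ∧ inF F (rightCell a)

-- a cell of F bordering the arc (used to choose the copy at pinch points)
cellOf : List Cell → Arc → Cell
cellOf F a = if inF F (leftCell a) then leftCell a else rightCell a

copyAt : List Cell → Point → Cell → Bool
copyAt F p c = pinch F p ∧ does (proj₂ c ℤ.≟ proj₂ p)

src : List Cell → Arc → Vertex
src F a = (proj₁ a , copyAt F (proj₁ a) (cellOf F a))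

tgt : List Cell → Arc → Vertex
tgt F a = (headP a , copyAt F (headP a) (cellOf F a))

sumℤ : List ℤ → ℤ
sumℤ = foldr _+_ (+ 0)

gsum : (Arc → ℤ) → List Arc → ℤ
gsum g P = sumℤ (map g P)

chain : List Cell → Arc → List Arc → Arc → Set
chain F prev []      first = tgt F prev ≡ src F first
chain F prev (b ∷ r) first = tgt F prev ≡ src F b × chain F b r first

IsCycle : List Cell → List Arc → Set
IsCycle F []      = ⊥
IsCycle F (a ∷ r) = chain F a r a × All (InE F) (a ∷ r)

ElemCycle : List Cell → List Arc → Set
ElemCycle F C = IsCycle F C × 3 ℕ.≤ length C × Unique (map (src F) C)

-- winding number of a closed path around (the centre of) cell (i , j),
-- computed by counting signed crossings of the rightward horizontal ray
windContrib : Cell → Arc → ℤ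
windContrib (i , j) ((x , y) , N) =
  if does (i ℤ.<? x) ∧ does (y ℤ.≟ j) then + 1 else + 0
windContrib (i , j) ((x , y) , S) =
  if does (i ℤ.<? x) ∧ does (y ℤ.≟ j + + 1) then - (+ 1) else + 0
windContrib _ _ = + 0

wind : List Arc → Cell → ℤ
wind C c = gsum (windContrib c) C

-- signed (counterclockwise-positive) enclosed area
areaContrib : Arc → ℤ
areaContrib ((x , y) , N) = x
areaContrib ((x , y) , S) = - x
areaContrib _ = + 0

Clockwise : List Arc → Set
Clockwise C = gsum areaContrib C < + 0

-- Dis_F(C): black minus white cells of F enclosed by a clockwise cycle
-- (enclosed cells of a clockwise elementary cycle have winding number -1)
Dis : List Cell → List Arc → ℤ
Dis F C = sumℤ (map (λ c → (- wind C c) * colour c) F)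

Equilibrium : List Cell → (Arc → ℤ) → Set
Equilibrium F eq =
  (∀ a → InE F a → eq (rev a) ≡ - eq a) ×
  (∀ C → ElemCycle F C → Clockwise C → gsum sp C + gsum eq C ≡ + 4 * Dis F C)

tF : List Cell → (Arc → ℤ) → Arc → ℤ
tF F eq a = if interior F a then eq a - sp a + + 2 else eq a + sp a

bF : List Cell → (Arc → ℤ) → Arc → ℤ
bF F eq a = if interior F a then eq a - sp a - + 2 else eq a + sp a

D : List Cell → (Vertex → ℤ) → Arc → ℤ
D F h a = h (tgt F a) - h (src F a)

IsHeight : List Cell → (Arc → ℤ) → Vertex → (Vertex → ℤ) → Set
IsHeight F eq w0 h =
  h w0 ≡ + 0 × (∀ a → InE F a → D F h a ≡ bF F eq a ⊎ D F h a ≡ tF F eq a)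

_≤H[_]_ : (Vertex → ℤ) → List Cell → (Vertex → ℤ) → Set
h ≤H[ F ] h' = ∀ v → InV F v → h v ≤ h' v

Critical : List Cell → (Arc → ℤ) → List Arc → Set
Critical F eq C = ElemCycle F C × gsum (tF F eq) C ≡ + 0

CommonCrit : List Cell → (Arc → ℤ) → Vertex → Vertex → Set
CommonCrit F eq v v' = Σ (List Arc) λ C →
  Critical F eq C × v ∈ map (src F) C × v' ∈ map (src F) C

-- the equivalence relation generated (it is already symmetric)
ForcedEq : List Cell → (Arc → ℤ) → Vertex → Vertex → Set
ForcedEq F eq = Star (CommonCrit F eq)

Adj8 : Cell → Cell → Set
Adj8 (x , y) (x' , y') =
  (x , y) ≢ (x' , y') × ∣ x' - x ∣ ℕ.≤ 1 × ∣ y' - y ∣ ℕ.≤ 1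

Adj8Out : List Cell → Cell → Cell → Set
Adj8Out F c c' = c ∉ F × c' ∉ F × Adj8 c c'

-- c lies in H_∞: it is outside F and 8-connected, outside F, to a cell
-- lying strictly to the right of every cell of F
InHinf : List Cell → Cell → Set
InHinf F c = c ∉ F × Σ Cell λ d →
  Star (Adj8Out F) c d × All (λ e → proj₁ e < proj₁ d) F

OnBoundaryHinf : List Cell → Vertex → Set
OnBoundaryHinf F (p , b) =
  InV F (p , b) × Σ Cell λ c → InHinf F c × Corner p c

{-# OPTIONS --safe #-}
module Submission where

-- Write "a is tight for h" when D h a = t a. Suppose hmin v = hmax v. If no hmax-tight
-- walk led from v to w0, lowering hmax by 4 on the vertices it tightly reaches from v
-- would give a height function below hmin at v; symmetrically, raising hmin by 4 on the
-- vertices tightly reaching v shows that an hmin-tight walk leads from w0 to v. Since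
-- hmin and hmax agree at v and at w0 and D h ≤ t on every arc, that walk is hmax-tight
-- too, so v and w0 lie on a closed hmax-tight walk. It splits into elementary cycles,
-- critical because t sums to a height difference 0 along them, and into back-and-forth
-- pairs of arcs. An arc tight in both directions has t = b, so it is a boundary arc, and
-- its endpoints lie on the boundary cycle of F, which is critical as well.

open import Defs
open import Data.Integer using (ℤ)
open import Data.List using (List)
open import Relation.Nullary using (¬_)
open import Relation.Binary.PropositionalEquality using (_≢_)

open import Data.Bool as Bool using (Bool; true; false; not; _∧_; _∨_; if_then_else_)
open import Data.Bool.Properties using (not-involutive; not-injective; ¬-not; ∧-inverseˡ; ∧-inverseʳ; ∧-comm; ∧-identityʳ; ∨-comm; ∨-identityʳ)
open import Data.Empty using (⊥; ⊥-elim)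
open import Data.Fin as Fin using (Fin; toℕ)
open import Data.Fin.Properties using (pigeonhole)
open import Data.Integer as ℤ using (+_; -[1+_]; -_; _+_; _-_)
import Data.Integer.Properties as ℤ
open import Algebra.Properties.AbelianGroup ℤ.+-0-abelianGroup using (identityʳ-unique; ∙-cancelˡ)
open import Data.Integer.Tactic.RingSolver using (solve-∀)
open import Data.List using ([]; _∷_; _++_; length; map; concatMap)
open import Data.List.Membership.Propositional using (_∈_; lose)
open import Data.List.Membership.Propositional.Properties using (∈-concatMap⁺; ∈-map⁺; ∈-++⁺ˡ; ∈-++⁺ʳ; ∈-++⁻)
open import Data.List.Membership.Setoid.Properties using (index-injective)
open import Data.List.Properties using (map-++; length-++)
open import Data.List.Relation.Unary.All as All using (All; []; _∷_)
open import Data.List.Relation.Unary.All.Properties using (¬Any⇒All¬)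
open import Data.List.Relation.Unary.AllPairs using ([]; _∷_)
open import Data.List.Relation.Unary.Any as Any using (here; there; tail)
open import Data.List.Relation.Unary.Unique.Propositional using (Unique)
open import Data.Nat as ℕ using (ℕ; zero; suc)
import Data.Nat.Properties as ℕ
open import Data.Nat.DivMod using (_%_)
open import Data.Nat.GeneralisedArithmetic using (fold; iterate; iterate-is-fold)
open import Data.Product using (Σ; ∃₂; _×_; _,_; proj₁; proj₂)
open import Data.Product.Properties using (≡-dec)
open import Data.Sum as Sum using (_⊎_; inj₁; inj₂; [_,_])
open import Function using (_∘_; id)
open import Relation.Binary.Construct.Closure.ReflexiveTransitive as Star using (Star; ε; _◅_; _◅◅_)
open import Relation.Binary.Definitions using (DecidableEquality)
open import Relation.Binary.PropositionalEquality using (_≡_; refl; sym; trans; cong; cong₂; subst; subst₂; setoid; module ≡-Reasoning)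
open import Relation.Nullary using (Dec; yes; no; does; proof)
open import Relation.Nullary.Decidable using (¬¬-excluded-middle; dec-true; dec-false)
open import Relation.Nullary.Negation using (contradiction)
open import Relation.Nullary.Reflects using (Reflects; ofʸ; ofⁿ; invert; det)

shift≢ : ∀ x k → k ≢ + 0 → x + k ≢ x
shift≢ x k k≢0 = k≢0 ∘ identityʳ-unique x k

shift-twice≢ : ∀ x k → k + k ≢ + 0 → x + k + k ≢ x
shift-twice≢ x k k+k≢0 = shift≢ x (k + k) k+k≢0 ∘ trans (sym (ℤ.+-assoc x k k))

+-tight : ∀ {x y X Y : ℤ} → x ℤ.≤ y → X ℤ.≤ Y → x + X ≡ y + Y → x ≡ y × X ≡ Y
+-tight {x} {y} {X} {Y} x≤y X≤Y same with x ℤ.≟ y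
... | yes refl = refl , ∙-cancelˡ x X Y same
... | no x≢y   = contradiction same (ℤ.<⇒≢ (ℤ.+-mono-<-≤ (ℤ.≤∧≢⇒< x≤y x≢y) X≤Y))

x+4-4≡x : ∀ x → x + + 4 - + 4 ≡ x
x+4-4≡x = solve-∀

x≰x-4 : ∀ x → ¬ (x ℤ.≤ x - + 4)
x≰x-4 x x≤x-4 = shift≢ x (- + 4) (λ ()) (ℤ.≤-antisym (ℤ.i-j≤i x (+ 4)) x≤x-4)

x+4≰x : ∀ x → ¬ (x + + 4 ℤ.≤ x)
x+4≰x x x+4≤x = shift≢ x (+ 4) (λ ()) (ℤ.≤-antisym x+4≤x (ℤ.i≤i+j x (+ 4)))

≡true⇒≢false : ∀ {b} → b ≡ true → b ≢ false
≡true⇒≢false refl ()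

true⊎false : ∀ b → b ≡ true ⊎ b ≡ false
true⊎false true  = inj₁ refl
true⊎false false = inj₂ refl

module _ {X : Set} (_≟_ : DecidableEquality X) (A : X → Set) where

  ¬¬-reflects : ∀ xs → ¬ ¬ (Σ (X → Bool) λ d → ∀ {x} → x ∈ xs → Reflects (A x) (d x))
  ¬¬-reflects [] k = k ((λ _ → false) , λ ())
  ¬¬-reflects (x ∷ xs) k = ¬¬-reflects xs λ (d , d-reflects) → ¬¬-excluded-middle λ x? →
    k ((λ y → if does (y ≟ x) then does x? else d y) , extended d d-reflects x?)
    where
    extended : ∀ d → (∀ {y} → y ∈ xs → Reflects (A y) (d y)) → (x? : Dec (A x)) →
               ∀ {y} → y ∈ x ∷ xs → Reflects (A y) (if does (y ≟ x) then does x? else d y)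
    extended d d-reflects x? {y} y∈ with y ≟ x
    ... | yes refl = proof x?
    ... | no y≢x = d-reflects (tail y≢x y∈)

module _ {A : Set} (f : A → A) {Q : A → Set}
         (f-preserves : ∀ {a} → Q a → Q (f a))
         (f-injective : ∀ {a b} → Q a → Q b → f a ≡ f b → a ≡ b) where

  iterate-preserves : ∀ n {a} → Q a → Q (iterate f a n)
  iterate-preserves zero    q = q
  iterate-preserves (suc n) q = iterate-preserves n (f-preserves q)

  iterate-cancel : ∀ i k {a} → Q a → iterate f a i ≡ iterate f a (i ℕ.+ k) → a ≡ iterate f a k
  iterate-cancel zero    k _ same = same
  iterate-cancel (suc i) k {a} q same = f-injective q (iterate-preserves k q) (begin
    f a                ≡⟨ iterate-cancel i k (f-preserves q) same ⟩
    iterate f (f a) k  ≡⟨ iterate-is-fold a f (suc k) ⟨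
    fold a f (suc k)   ≡⟨ cong f (iterate-is-fold a f k) ⟩
    f (iterate f a k)  ∎)
    where open ≡-Reasoning

  iterate-returns : (xs : List A) → (∀ {a} → Q a → a ∈ xs) → ∀ {a} → Q a → Σ ℕ λ k → iterate f (f a) k ≡ a
  iterate-returns xs Q⊆xs {a} q = returns (pigeonhole (ℕ.n<1+n (length xs)) position)
    where
    position : Fin (suc (length xs)) → Fin (length xs)
    position i = Any.index (Q⊆xs (iterate-preserves (toℕ i) q))
    returns : (∃₂ λ i j → i Fin.< j × position i ≡ position j) → Σ ℕ λ k → iterate f (f a) k ≡ a
    returns (i , j , i<j , same) with ℕ.m≤n⇒∃[o]m+o≡n i<j
    ... | o , i+o≡j = o , sym (iterate-cancel (toℕ i) (suc o) q (begin
      iterate f a (toℕ i)             ≡⟨ index-injective (setoid A) _ _ same ⟩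
      iterate f a (toℕ j)             ≡⟨ cong (iterate f a) (trans (sym i+o≡j) (sym (ℕ.+-suc (toℕ i) o))) ⟩
      iterate f a (toℕ i ℕ.+ suc o)   ∎))
      where open ≡-Reasoning

-- Grid geometry

x+1-1≡x : ∀ x → x + + 1 - + 1 ≡ x
x+1-1≡x = solve-∀

x-1+1≡x : ∀ x → x - + 1 + + 1 ≡ x
x-1+1≡x = solve-∀

step≢ : ∀ p d → step p d ≢ p
step≢ (x , y) E = shift≢ x (+ 1) (λ ()) ∘ cong proj₁
step≢ (x , y) N = shift≢ y (+ 1) (λ ()) ∘ cong proj₂
step≢ (x , y) W = shift≢ x (- + 1) (λ ()) ∘ cong proj₁
step≢ (x , y) S = shift≢ y (- + 1) (λ ()) ∘ cong proj₂

step-opp : ∀ p d → step (step p d) (opp d) ≡ p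
step-opp (x , y) E = cong (_, y) (x+1-1≡x x)
step-opp (x , y) N = cong (x ,_) (x+1-1≡x y)
step-opp (x , y) W = cong (_, y) (x-1+1≡x x)
step-opp (x , y) S = cong (x ,_) (x-1+1≡x y)

step-step≡⇒opp : ∀ p d d' → step (step p d) d' ≡ p → d' ≡ opp d
step-step≡⇒opp p E W _ = refl
step-step≡⇒opp p N S _ = refl
step-step≡⇒opp p W E _ = refl
step-step≡⇒opp p S N _ = refl
step-step≡⇒opp (x , y) E E = ⊥-elim ∘ shift-twice≢ x (+ 1) (λ ()) ∘ cong proj₁
step-step≡⇒opp (x , y) E N = ⊥-elim ∘ shift≢ x (+ 1) (λ ()) ∘ cong proj₁
step-step≡⇒opp (x , y) E S = ⊥-elim ∘ shift≢ x (+ 1) (λ ()) ∘ cong proj₁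
step-step≡⇒opp (x , y) N E = ⊥-elim ∘ shift≢ y (+ 1) (λ ()) ∘ cong proj₂
step-step≡⇒opp (x , y) N N = ⊥-elim ∘ shift-twice≢ y (+ 1) (λ ()) ∘ cong proj₂
step-step≡⇒opp (x , y) N W = ⊥-elim ∘ shift≢ y (+ 1) (λ ()) ∘ cong proj₂
step-step≡⇒opp (x , y) W N = ⊥-elim ∘ shift≢ x (- + 1) (λ ()) ∘ cong proj₁
step-step≡⇒opp (x , y) W W = ⊥-elim ∘ shift-twice≢ x (- + 1) (λ ()) ∘ cong proj₁
step-step≡⇒opp (x , y) W S = ⊥-elim ∘ shift≢ x (- + 1) (λ ()) ∘ cong proj₁
step-step≡⇒opp (x , y) S E = ⊥-elim ∘ shift≢ y (- + 1) (λ ()) ∘ cong proj₂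
step-step≡⇒opp (x , y) S W = ⊥-elim ∘ shift≢ y (- + 1) (λ ()) ∘ cong proj₂
step-step≡⇒opp (x , y) S S = ⊥-elim ∘ shift-twice≢ y (- + 1) (λ ()) ∘ cong proj₂

rev-involutive : ∀ a → rev (rev a) ≡ a
rev-involutive (p , d) = cong₂ _,_ (step-opp p d) (opp-involutive d)
  where
  opp-involutive : ∀ d → opp (opp d) ≡ d
  opp-involutive E = refl
  opp-involutive N = refl
  opp-involutive W = refl
  opp-involutive S = refl

returning-arc≡rev : ∀ a a' → proj₁ a' ≡ headP a → headP a' ≡ proj₁ a → a' ≡ rev a
returning-arc≡rev (p , d) (.(step p d) , d') refl back = cong (step p d ,_) (step-step≡⇒opp p d d' back)

leftCell-rev : ∀ a → leftCell (rev a) ≡ rightCell a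
leftCell-rev ((x , y) , E) = cong (_, y - + 1) (x+1-1≡x x)
leftCell-rev ((x , y) , N) = cong (x ,_) (x+1-1≡x y)
leftCell-rev ((x , y) , W) = refl
leftCell-rev ((x , y) , S) = refl

rightCell-rev : ∀ a → rightCell (rev a) ≡ leftCell a
rightCell-rev a = trans (sym (leftCell-rev (rev a))) (cong leftCell (rev-involutive a))

lt rt : Dir → Dir
lt E = N
lt N = W
lt W = S
lt S = E
rt E = S
rt N = E
rt W = N
rt S = W

rightCell-lt : ∀ p d → rightCell (p , lt d) ≡ leftCell (p , d)
rightCell-lt (x , y) E = refl
rightCell-lt (x , y) N = refl
rightCell-lt (x , y) W = refl
rightCell-lt (x , y) S = refl

leftCell-rt : ∀ p d → leftCell (p , rt d) ≡ rightCell (p , d)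
leftCell-rt (x , y) E = refl
leftCell-rt (x , y) N = refl
leftCell-rt (x , y) W = refl
leftCell-rt (x , y) S = refl

leftCell-step-lt : ∀ p d → leftCell (step p d , lt d) ≡ leftCell (p , d)
leftCell-step-lt (x , y) E = cong (_, y) (x+1-1≡x x)
leftCell-step-lt (x , y) N = cong (x - + 1 ,_) (x+1-1≡x y)
leftCell-step-lt (x , y) W = refl
leftCell-step-lt (x , y) S = refl

rightCell-step-rt : ∀ p d → rightCell (step p d , rt d) ≡ rightCell (p , d)
rightCell-step-rt (x , y) E = cong (_, y - + 1) (x+1-1≡x x)
rightCell-step-rt (x , y) N = cong (x ,_) (x+1-1≡x y)
rightCell-step-rt (x , y) W = refl
rightCell-step-rt (x , y) S = refl

rightSides : Cell → List Arc
rightSides (x , y) = ((x , y + + 1) , E) ∷ ((x , y) , N) ∷ ((x + + 1 , y) , W) ∷ ((x + + 1 , y + + 1) , S) ∷ []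

∈-rightSides : ∀ a → a ∈ rightSides (rightCell a)
∈-rightSides ((x , y) , E) = here (cong (λ y → (x , y) , E) (sym (x-1+1≡x y)))
∈-rightSides ((x , y) , N) = there (here refl)
∈-rightSides ((x , y) , W) = there (there (here (cong (λ x → (x , y) , W) (sym (x-1+1≡x x)))))
∈-rightSides ((x , y) , S) =
  there (there (there (here (cong₂ (λ x y → (x , y) , S) (sym (x-1+1≡x x)) (sym (x-1+1≡x y))))))

even : ℤ → Bool
even z = does ((ℤ.∣ z ∣ % 2) ℕ.≟ 0)

-- The last clause holds because suc (suc n) % 2 computes to n % 2.
evenℕ-suc : ∀ n → does ((suc n % 2) ℕ.≟ 0) ≡ not (does ((n % 2) ℕ.≟ 0))
evenℕ-suc zero = refl
evenℕ-suc (suc zero) = refl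
evenℕ-suc (suc (suc n)) = evenℕ-suc n

even-suc : ∀ z → even (z + + 1) ≡ not (even z)
even-suc (+ n) = trans (cong (λ m → does ((m % 2) ℕ.≟ 0)) (ℕ.+-comm n 1)) (evenℕ-suc n)
even-suc -[1+ zero ] = refl
even-suc -[1+ suc n ] = sym (trans (cong not (evenℕ-suc (suc n))) (not-involutive _))

even-pred : ∀ z → even (z - + 1) ≡ not (even z)
even-pred z = begin
  even (z - + 1)             ≡⟨ not-involutive _ ⟨
  not (not (even (z - + 1))) ≡⟨ cong not (even-suc (z - + 1)) ⟨
  not (even (z - + 1 + + 1)) ≡⟨ cong (not ∘ even) (x-1+1≡x z) ⟩
  not (even z)               ∎
  where open ≡-Reasoning

isBlack-rightCell : ∀ a → isBlack (rightCell a) ≡ not (isBlack (leftCell a))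
isBlack-rightCell ((x , y) , E) = trans (cong even (sym (ℤ.+-assoc x y (- + 1)))) (even-pred (x + y))
isBlack-rightCell ((x , y) , N) = begin
  even (x + y)                   ≡⟨ not-involutive _ ⟨
  not (not (even (x + y)))       ≡⟨ cong not (even-pred (x + y)) ⟨
  not (even (x + y - + 1))       ≡⟨ cong (not ∘ even) (reorder x y) ⟩
  not (even (x - + 1 + y))       ∎
  where
  open ≡-Reasoning
  reorder : ∀ x y → x + y - + 1 ≡ x - + 1 + y
  reorder = solve-∀
isBlack-rightCell ((x , y) , W) = trans (cong even (reorder x y)) (even-suc (x - + 1 + (y - + 1)))
  where
  reorder : ∀ x y → x - + 1 + y ≡ x - + 1 + (y - + 1) + + 1
  reorder = solve-∀
isBlack-rightCell ((x , y) , S) = trans (cong even (reorder x y)) (even-pred (x + (y - + 1)))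
  where
  reorder : ∀ x y → x - + 1 + (y - + 1) ≡ x + (y - + 1) - + 1
  reorder = solve-∀

sp-rev : ∀ a → sp (rev a) ≡ - sp a
sp-rev a rewrite leftCell-rev a | isBlack-rightCell a with isBlack (leftCell a)
... | true = refl
... | false = refl

pinch-diagonal : ∀ sw se nw ne → (sw ∧ ne ∧ not se ∧ not nw) ∨ (se ∧ nw ∧ not sw ∧ not ne) ≡ true →
                 ne ≡ sw × se ≡ not sw × nw ≡ not sw
pinch-diagonal true  false false true  _ = refl , refl , refl
pinch-diagonal false true  true  false _ = refl , refl , refl
pinch-diagonal true  true  true  true  ()
pinch-diagonal true  true  true  false ()
pinch-diagonal true  true  false true  ()
pinch-diagonal true  true  false false ()
pinch-diagonal true  false true  true  ()
pinch-diagonal true  false true  false ()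
pinch-diagonal true  false false false ()
pinch-diagonal false true  true  true  ()
pinch-diagonal false true  false true  ()
pinch-diagonal false true  false false ()
pinch-diagonal false false true  true  ()
pinch-diagonal false false true  false ()
pinch-diagonal false false false true  ()
pinch-diagonal false false false false ()

_≟ᵥ_ : DecidableEquality Vertex
_≟ᵥ_ = ≡-dec _≟p_ Bool._≟_

open import Data.List.Membership.DecPropositional _≟ᵥ_ using () renaming (_∈?_ to _∈ᵥ?_)

inF⇒∈ : ∀ F {c} → inF F c ≡ true → c ∈ F
inF⇒∈ (d ∷ F) {c} c∈F with c ≟p d
... | yes c≡d = here c≡d
... | no _    = there (inF⇒∈ F c∈F)

-- Pinch points, reversal and boundary arcs of G_F

module _ (F : List Cell) where

  Checkerboard : Point → Set
  Checkerboard (x , y) =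
    inF F (x , y) ≡ sw × inF F (x , y - + 1) ≡ not sw × inF F (x - + 1 , y) ≡ not sw
    where sw = inF F (x - + 1 , y - + 1)

  pinch⇒checkerboard : ∀ p → pinch F p ≡ true → Checkerboard p
  pinch⇒checkerboard (x , y) = pinch-diagonal _ _ _ _

  checkerboard⇒¬interior : ∀ a → Checkerboard (proj₁ a) → interior F a ≡ false
  checkerboard⇒¬interior ((x , y) , E) (ne , se , nw) rewrite ne | se = ∧-inverseʳ (inF F (x - + 1 , y - + 1))
  checkerboard⇒¬interior ((x , y) , N) (ne , se , nw) rewrite ne | nw = ∧-inverseˡ (inF F (x - + 1 , y - + 1))
  checkerboard⇒¬interior ((x , y) , W) (ne , se , nw) rewrite nw = ∧-inverseʳ (inF F (x - + 1 , y - + 1))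
  checkerboard⇒¬interior ((x , y) , S) (ne , se , nw) rewrite se = ∧-inverseˡ (inF F (x - + 1 , y - + 1))

  interior⇒¬pinch : ∀ a → interior F a ≡ true → pinch F (proj₁ a) ≡ false
  interior⇒¬pinch a inner = ¬-not λ pinched →
    ≡true⇒≢false inner (checkerboard⇒¬interior a (pinch⇒checkerboard (proj₁ a) pinched))

  diagonal⇒pinch : ∀ x y → inF F (x - + 1 , y - + 1) ≡ true → inF F (x , y) ≡ true →
                   inF F (x , y - + 1) ≡ false → inF F (x - + 1 , y) ≡ false → pinch F (x , y) ≡ true
  diagonal⇒pinch _ _ sw ne se nw rewrite sw | ne | se | nw = refl

  antidiagonal⇒pinch : ∀ x y → inF F (x , y - + 1) ≡ true → inF F (x - + 1 , y) ≡ true →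
                       inF F (x - + 1 , y - + 1) ≡ false → inF F (x , y) ≡ false → pinch F (x , y) ≡ true
  antidiagonal⇒pinch _ _ se nw sw ne rewrite sw | ne | se | nw = refl

  copyAt-¬pinch : ∀ p c c' → pinch F p ≡ false → copyAt F p c ≡ copyAt F p c'
  copyAt-¬pinch p c c' unpinched =
    trans (cong (_∧ does (proj₂ c ℤ.≟ proj₂ p)) unpinched)
          (sym (cong (_∧ does (proj₂ c' ℤ.≟ proj₂ p)) unpinched))

  pinch-separates-rows : ∀ x y x₁ x₂ → pinch F (x , y) ≡ true →
                         copyAt F (x , y) (x₁ , y - + 1) ≢ copyAt F (x , y) (x₂ , y)
  pinch-separates-rows _ y _ _ pinched
    rewrite pinched | dec-false (y - + 1 ℤ.≟ y) (shift≢ y (- + 1) (λ ())) | dec-true (y ℤ.≟ y) refl = λ ()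

  interior-rev : ∀ a → interior F (rev a) ≡ interior F a
  interior-rev a rewrite leftCell-rev a | rightCell-rev a = ∧-comm (inF F (rightCell a)) (inF F (leftCell a))

  InE-rev : ∀ {a} → InE F a → InE F (rev a)
  InE-rev {a} a∈E rewrite leftCell-rev a | rightCell-rev a = trans (∨-comm (inF F (rightCell a)) (inF F (leftCell a))) a∈E

  copyAt-cellOf-rev : ∀ {a} p → InE F a → (interior F a ≡ true → pinch F p ≡ false) →
                      copyAt F p (cellOf F (rev a)) ≡ copyAt F p (cellOf F a)
  copyAt-cellOf-rev {a} p a∈E unpinched rewrite leftCell-rev a | rightCell-rev a
    with inF F (leftCell a) | inF F (rightCell a)
  ... | true  | true  = copyAt-¬pinch p (rightCell a) (leftCell a) (unpinched refl)
  ... | true  | false = refl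
  ... | false | true  = refl
  ... | false | false = contradiction a∈E λ ()

  src-rev : ∀ {a} → InE F a → src F (rev a) ≡ tgt F a
  src-rev {a} a∈E = cong (headP a ,_) (copyAt-cellOf-rev (headP a) a∈E
    λ inner → interior⇒¬pinch (rev a) (trans (interior-rev a) inner))

  tgt-rev : ∀ {a} → InE F a → tgt F (rev a) ≡ src F a
  tgt-rev {a@(p , d)} a∈E = cong₂ _,_ (step-opp p d)
    (trans (cong (λ q → copyAt F q (cellOf F (rev a))) (step-opp p d))
           (copyAt-cellOf-rev p a∈E (interior⇒¬pinch a)))

  record RightBoundary (a : Arc) : Set where
    constructor right-boundary
    field
      right∈F : inF F (rightCell a) ≡ true
      left∉F  : inF F (leftCell a) ≡ false

  record LeftBoundary (a : Arc) : Set where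
    constructor left-boundary
    field
      left∈F   : inF F (leftCell a) ≡ true
      right∉F  : inF F (rightCell a) ≡ false

  RightBoundary⇒InE : ∀ {a} → RightBoundary a → InE F a
  RightBoundary⇒InE (right-boundary r l) = cong₂ _∨_ l r

  RightBoundary-rev : ∀ {a} → RightBoundary a → LeftBoundary (rev a)
  RightBoundary-rev {a} (right-boundary r l) =
    left-boundary (trans (cong (inF F) (leftCell-rev a)) r) (trans (cong (inF F) (rightCell-rev a)) l)

  cellOf-right : ∀ {a} → inF F (leftCell a) ≡ false → cellOf F a ≡ rightCell a
  cellOf-right l rewrite l = refl

  cellOf-left : ∀ {a} → inF F (leftCell a) ≡ true → cellOf F a ≡ leftCell a
  cellOf-left l rewrite l = refl

  -- This is what duplicating pinch vertices achieves: at a pinch point the two boundary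
  -- arcs leaving it start from different copies.
  LeftBoundary-src-injective : ∀ {a a'} → LeftBoundary a → LeftBoundary a' → src F a ≡ src F a' → a ≡ a'
  LeftBoundary-src-injective {p , d} {p' , d'} a∂ a'∂ same with cong proj₁ same
  ... | refl = cong (p ,_) (direction p d d' a∂ a'∂ flags)
    where
    flags : copyAt F p (leftCell (p , d)) ≡ copyAt F p (leftCell (p , d'))
    flags = trans (cong (copyAt F p) (sym (cellOf-left (LeftBoundary.left∈F a∂))))
                  (trans (cong proj₂ same) (cong (copyAt F p) (cellOf-left (LeftBoundary.left∈F a'∂))))
    direction : ∀ p d d' → LeftBoundary (p , d) → LeftBoundary (p , d') →
                copyAt F p (leftCell (p , d)) ≡ copyAt F p (leftCell (p , d')) → d ≡ d'
    direction _ E E _ _ _ = refl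
    direction _ N N _ _ _ = refl
    direction _ W W _ _ _ = refl
    direction _ S S _ _ _ = refl
    direction _ E N (left-boundary l _) (left-boundary _ r') _ = ⊥-elim (≡true⇒≢false l r')
    direction _ N W (left-boundary l _) (left-boundary _ r') _ = ⊥-elim (≡true⇒≢false l r')
    direction _ W S (left-boundary l _) (left-boundary _ r') _ = ⊥-elim (≡true⇒≢false l r')
    direction _ S E (left-boundary l _) (left-boundary _ r') _ = ⊥-elim (≡true⇒≢false l r')
    direction _ E S (left-boundary _ r) (left-boundary l' _) _ = ⊥-elim (≡true⇒≢false l' r)
    direction _ N E (left-boundary _ r) (left-boundary l' _) _ = ⊥-elim (≡true⇒≢false l' r)
    direction _ W N (left-boundary _ r) (left-boundary l' _) _ = ⊥-elim (≡true⇒≢false l' r)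
    direction _ S W (left-boundary _ r) (left-boundary l' _) _ = ⊥-elim (≡true⇒≢false l' r)
    direction (x , y) E W (left-boundary l r) (left-boundary l' r') flags =
      ⊥-elim (pinch-separates-rows x y (x - + 1) x (diagonal⇒pinch x y l' l r r') (sym flags))
    direction (x , y) W E (left-boundary l r) (left-boundary l' r') flags =
      ⊥-elim (pinch-separates-rows x y (x - + 1) x (diagonal⇒pinch x y l l' r' r) flags)
    direction (x , y) N S (left-boundary l r) (left-boundary l' r') flags =
      ⊥-elim (pinch-separates-rows x y x (x - + 1) (antidiagonal⇒pinch x y l' l r' r) (sym flags))
    direction (x , y) S N (left-boundary l r) (left-boundary l' r') flags =
      ⊥-elim (pinch-separates-rows x y x (x - + 1) (antidiagonal⇒pinch x y l l' r r') flags)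

  RightBoundary-tgt-injective : ∀ {a a'} → RightBoundary a → RightBoundary a' → tgt F a ≡ tgt F a' → a ≡ a'
  RightBoundary-tgt-injective {a} {a'} a∂ a'∂ same = begin
    a             ≡⟨ rev-involutive a ⟨
    rev (rev a)   ≡⟨ cong rev (LeftBoundary-src-injective (RightBoundary-rev a∂) (RightBoundary-rev a'∂) src≡) ⟩
    rev (rev a')  ≡⟨ rev-involutive a' ⟩
    a'            ∎
    where
    open ≡-Reasoning
    src≡ : src F (rev a) ≡ src F (rev a')
    src≡ = trans (src-rev (RightBoundary⇒InE a∂)) (trans same (sym (src-rev (RightBoundary⇒InE a'∂))))

  next : Arc → Arc
  next (p , d) =
    if inF F (rightCell (step p d , d))
    then (if inF F (leftCell (step p d , d)) then (step p d , lt d) else (step p d , d))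
    else (step p d , rt d)

  data NextCase (p : Point) (d : Dir) : Arc → Set where
    turn-left   : inF F (rightCell (step p d , d)) ≡ true → inF F (leftCell (step p d , d)) ≡ true →
                  NextCase p d (step p d , lt d)
    go-straight : inF F (rightCell (step p d , d)) ≡ true → inF F (leftCell (step p d , d)) ≡ false →
                  NextCase p d (step p d , d)
    turn-right  : inF F (rightCell (step p d , d)) ≡ false → NextCase p d (step p d , rt d)

  next-case : ∀ p d → NextCase p d (next (p , d))
  next-case p d with inF F (rightCell (step p d , d)) in r | inF F (leftCell (step p d , d)) in l
  ... | true  | true  = turn-left r l
  ... | true  | false = go-straight r l
  ... | false | _     = turn-right r

  next-RightBoundary : ∀ {a} → RightBoundary a → RightBoundary (next a)
  next-RightBoundary {p , d} (right-boundary r l) with next (p , d) | next-case p d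
  ... | _ | turn-left r' l' = right-boundary (trans (cong (inF F) (rightCell-lt (step p d) d)) l')
                                             (trans (cong (inF F) (leftCell-step-lt p d)) l)
  ... | _ | go-straight r' l' = right-boundary r' l'
  ... | _ | turn-right r' = right-boundary (trans (cong (inF F) (rightCell-step-rt p d)) r)
                                           (trans (cong (inF F) (leftCell-rt (step p d) d)) r')

  right-cells⇒¬pinch : ∀ p d → inF F (rightCell (p , d)) ≡ true → inF F (rightCell (step p d , d)) ≡ true →
                       pinch F (step p d) ≡ false
  right-cells⇒¬pinch p d r r' = interior⇒¬pinch (step p d , rt d)
    (cong₂ _∧_ (trans (cong (inF F) (leftCell-rt (step p d) d)) r') (trans (cong (inF F) (rightCell-step-rt p d)) r))

  next-chain : ∀ {a} → RightBoundary a → tgt F a ≡ src F (next a)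
  next-chain {p , d} (right-boundary r l) with next (p , d) | next-case p d
  ... | _ | turn-left r' _ = cong (step p d ,_)
    (copyAt-¬pinch (step p d) (cellOf F (p , d)) (cellOf F (step p d , lt d)) (right-cells⇒¬pinch p d r r'))
  ... | _ | go-straight r' _ = cong (step p d ,_)
    (copyAt-¬pinch (step p d) (cellOf F (p , d)) (cellOf F (step p d , d)) (right-cells⇒¬pinch p d r r'))
  ... | _ | turn-right r' = cong (λ c → step p d , copyAt F (step p d) c) (begin
    cellOf F (p , d)               ≡⟨ cellOf-right l ⟩
    rightCell (p , d)              ≡⟨ rightCell-step-rt p d ⟨
    rightCell (step p d , rt d)    ≡⟨ cellOf-right (trans (cong (inF F) (leftCell-rt (step p d) d)) r') ⟨
    cellOf F (step p d , rt d)     ∎)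
    where open ≡-Reasoning

  next-injective : ∀ {a a'} → RightBoundary a → RightBoundary a' → next a ≡ next a' → a ≡ a'
  next-injective a∂ a'∂ same =
    RightBoundary-tgt-injective a∂ a'∂ (trans (next-chain a∂) (trans (cong (src F) same) (sym (next-chain a'∂))))

  RightBoundary⇒∈ : ∀ {a} → RightBoundary a → a ∈ concatMap rightSides F
  RightBoundary⇒∈ {a} (right-boundary r _) = ∈-concatMap⁺ rightSides (lose (inF⇒∈ F r) (∈-rightSides a))

  -- Walks in G_F

  Link : (Arc → Set) → Vertex → Vertex → Set
  Link P u v = Σ Arc λ a → P a × src F a ≡ u × tgt F a ≡ v

  Walk : (Arc → Set) → Vertex → Vertex → Set
  Walk P = Star (Link P)

  module _ {P : Arc → Set} where

    arcs : ∀ {u v} → Walk P u v → List Arc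
    arcs ε              = []
    arcs ((a , _) ◅ ws) = a ∷ arcs ws

    srcs : ∀ {u v} → Walk P u v → List Vertex
    srcs ws = map (src F) (arcs ws)

    arcs-◅◅ : ∀ {u v w} (ws : Walk P u v) (ws' : Walk P v w) → arcs (ws ◅◅ ws') ≡ arcs ws ++ arcs ws'
    arcs-◅◅ ε              ws' = refl
    arcs-◅◅ ((a , _) ◅ ws) ws' = cong (a ∷_) (arcs-◅◅ ws ws')

    srcs-◅◅ : ∀ {u v w} (ws : Walk P u v) (ws' : Walk P v w) → srcs (ws ◅◅ ws') ≡ srcs ws ++ srcs ws'
    srcs-◅◅ ws ws' = trans (cong (map (src F)) (arcs-◅◅ ws ws')) (map-++ (src F) (arcs ws) (arcs ws'))

    arcs-All : ∀ {u v} (ws : Walk P u v) → All P (arcs ws)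
    arcs-All ε                    = []
    arcs-All ((_ , pa , _) ◅ ws) = pa ∷ arcs-All ws

    walk-chain : ∀ prev first {v w} (ws : Walk P v w) → tgt F prev ≡ v → w ≡ src F first →
                 chain F prev (arcs ws) first
    walk-chain prev first ε                           prev↦ end = trans prev↦ end
    walk-chain prev first ((a , _ , a← , a↦) ◅ ws) prev↦ end = trans prev↦ (sym a←) , walk-chain a first ws a↦ end

    ∈-detour : ∀ {u x w z} (before : Walk P u x) (detour : Walk P x x) (rest : Walk P x w) →
               z ∈ srcs (before ◅◅ detour ◅◅ rest) → z ∈ srcs (before ◅◅ rest) ⊎ z ∈ srcs detour
    ∈-detour before detour rest z∈
      rewrite srcs-◅◅ before (detour ◅◅ rest) | srcs-◅◅ detour rest | srcs-◅◅ before rest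
      with ∈-++⁻ (srcs before) z∈
    ... | inj₁ z∈before = inj₁ (∈-++⁺ˡ z∈before)
    ... | inj₂ z∈later with ∈-++⁻ (srcs detour) z∈later
    ...   | inj₁ z∈detour = inj₂ z∈detour
    ...   | inj₂ z∈rest   = inj₁ (∈-++⁺ʳ (srcs before) z∈rest)

    nonempty : ∀ {u x y w} (before : Walk P u x) (l : Link P x y) (after : Walk P y w) →
               0 ℕ.< length (arcs (before ◅◅ l ◅ after))
    nonempty ε       _ _ = ℕ.s≤s ℕ.z≤n
    nonempty (_ ◅ _) _ _ = ℕ.s≤s ℕ.z≤n

    length-detour : ∀ {u x w} (before : Walk P u x) (detour : Walk P x x) (rest : Walk P x w) →
                    length (arcs (before ◅◅ detour ◅◅ rest)) ≡ length (arcs (before ◅◅ rest)) ℕ.+ length (arcs detour)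
    length-detour before detour rest
      rewrite arcs-◅◅ before (detour ◅◅ rest) | arcs-◅◅ detour rest | arcs-◅◅ before rest
            | length-++ (arcs before) {arcs detour ++ arcs rest} | length-++ (arcs detour) {arcs rest}
            | length-++ (arcs before) {arcs rest} =
      trans (cong (length (arcs before) ℕ.+_) (ℕ.+-comm (length (arcs detour)) (length (arcs rest))))
            (sym (ℕ.+-assoc (length (arcs before)) (length (arcs rest)) (length (arcs detour))))

    shortcut-shorter : ∀ {u x y w} (before : Walk P u x) (l : Link P x y) (loop : Walk P y x) (rest : Walk P x w) →
                       length (arcs (before ◅◅ rest)) ℕ.< length (arcs (before ◅◅ (l ◅ loop) ◅◅ rest))
    shortcut-shorter before l loop rest =
      subst (length (arcs (before ◅◅ rest)) ℕ.<_) (sym (length-detour before (l ◅ loop) rest))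
            (ℕ.m<m+n _ (ℕ.s≤s ℕ.z≤n))

    detour-shorter : ∀ {u x z w} (before : Walk P u x) (detour : Walk P x x) (l : Link P x z) (after : Walk P z w) →
                     length (arcs detour) ℕ.< length (arcs (before ◅◅ detour ◅◅ l ◅ after))
    detour-shorter before detour l after =
      subst (length (arcs detour) ℕ.<_) (sym (length-detour before detour (l ◅ after))) (ℕ.m<n+m _ (nonempty before l after))

    record Split {u w} (ws : Walk P u w) (x : Vertex) : Set where
      constructor split
      field
        {y}    : Vertex
        prefix : Walk P u x
        link   : Link P x y
        suffix : Walk P y w
        splits : ws ≡ prefix ◅◅ link ◅ suffix

    split-at : ∀ {u w x} (ws : Walk P u w) → x ∈ srcs ws → Split ws x
    split-at ((a , pa , refl , a↦) ◅ ws) (here refl) = split ε (a , pa , refl , a↦) ws refl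
    split-at (l ◅ ws) (there x∈ws) with split-at ws x∈ws
    ... | split prefix link suffix refl = split (l ◅ prefix) link suffix refl

    record Repetition {u w} (ws : Walk P u w) : Set where
      constructor repetition
      field
        {x y z}   : Vertex
        before    : Walk P u x
        loop-link : Link P x y
        loop      : Walk P y x
        exit-link : Link P x z
        after     : Walk P z w
        splits    : ws ≡ before ◅◅ (loop-link ◅ loop) ◅◅ (exit-link ◅ after)

    simple-or-repeats : ∀ {u w} (ws : Walk P u w) → Unique (srcs ws) ⊎ Repetition ws
    simple-or-repeats ε = inj₁ []
    simple-or-repeats (l@(a , pa , refl , _) ◅ ws) with simple-or-repeats ws
    ... | inj₂ (repetition before ll loop el after refl) = inj₂ (repetition (l ◅ before) ll loop el after refl)
    ... | inj₁ ws-simple with src F a ∈ᵥ? srcs ws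
    ...   | no a∉ws = inj₁ (¬Any⇒All¬ (srcs ws) a∉ws ∷ ws-simple)
    ...   | yes a∈ws with split-at ws a∈ws
    ...     | split prefix link suffix refl = inj₂ (repetition ε l prefix link suffix refl)

  orbit : ∀ n {a} → RightBoundary a → Walk RightBoundary (src F a) (src F (iterate next a n))
  orbit zero    _ = ε
  orbit (suc n) {a} a∂ = (a , a∂ , refl , next-chain a∂) ◅ orbit n (next-RightBoundary a∂)

  -- next permutes the finitely many boundary arcs with F on their right, so iterating it
  -- from a comes back to a.
  boundary-return : ∀ {a} → RightBoundary a → Walk RightBoundary (tgt F a) (src F a)
  boundary-return {a} a∂ = close (iterate-returns next {RightBoundary} next-RightBoundary next-injective
                                                  (concatMap rightSides F) RightBoundary⇒∈ a∂)
    where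
    close : (Σ ℕ λ k → iterate next (next a) k ≡ a) → Walk RightBoundary (tgt F a) (src F a)
    close (k , returns) = subst₂ (Walk RightBoundary) (sym (next-chain a∂)) (cong (src F) returns)
                                 (orbit k (next-RightBoundary a∂))

  RightBoundary-no-two-cycle : ∀ {u v} → Link RightBoundary u v → Link RightBoundary v u → ⊥
  RightBoundary-no-two-cycle (a , a∂ , a← , a↦) (a' , a'∂ , a'← , a'↦) =
    ≡true⇒≢false (trans (cong (inF F) (sym (rightCell-rev a))) right∈F) (RightBoundary.left∉F a∂)
    where
    a'≡rev : a' ≡ rev a
    a'≡rev = returning-arc≡rev a a' (cong proj₁ (trans a'← (sym a↦))) (cong proj₁ (trans a'↦ (sym a←)))
    right∈F : inF F (rightCell (rev a)) ≡ true
    right∈F = subst (λ c → inF F (rightCell c) ≡ true) a'≡rev (RightBoundary.right∈F a'∂)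

  endpoints : List Vertex
  endpoints = map (src F) (concatMap rightSides F) ++ map (tgt F) (concatMap rightSides F)

  InE⇒right∈F⊎left∈F : ∀ {a} → InE F a → inF F (rightCell a) ≡ true ⊎ inF F (leftCell a) ≡ true
  InE⇒right∈F⊎left∈F {a} a∈E with inF F (rightCell a)
  ... | true  = inj₁ refl
  ... | false = inj₂ (trans (sym (∨-identityʳ (inF F (leftCell a)))) a∈E)

  ¬interior⇒RightBoundary : ∀ {a} → InE F a → interior F a ≡ false → RightBoundary a ⊎ RightBoundary (rev a)
  ¬interior⇒RightBoundary {a} a∈E boundary with InE⇒right∈F⊎left∈F {a} a∈E
  ... | inj₁ r = inj₁ (right-boundary r
    (trans (sym (∧-identityʳ (inF F (leftCell a)))) (subst (λ x → inF F (leftCell a) ∧ x ≡ false) r boundary)))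
  ... | inj₂ l = inj₂ (right-boundary (trans (cong (inF F) (rightCell-rev a)) l)
    (trans (cong (inF F) (leftCell-rev a)) (subst (λ x → x ∧ inF F (rightCell a) ≡ false) l boundary)))

  InE⇒endpoints : ∀ {a} → InE F a → src F a ∈ endpoints × tgt F a ∈ endpoints
  InE⇒endpoints {a} a∈E = [ right∈F , left∈F ] (InE⇒right∈F⊎left∈F {a} a∈E)
    where
    right∈F : inF F (rightCell a) ≡ true → src F a ∈ endpoints × tgt F a ∈ endpoints
    right∈F r = ∈-++⁺ˡ (∈-map⁺ (src F) a∈) , ∈-++⁺ʳ _ (∈-map⁺ (tgt F) a∈)
      where a∈ = ∈-concatMap⁺ rightSides (lose (inF⇒∈ F r) (∈-rightSides a))
    left∈F : inF F (leftCell a) ≡ true → src F a ∈ endpoints × tgt F a ∈ endpoints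
    left∈F l = subst (_∈ endpoints) (tgt-rev {a} a∈E) (∈-++⁺ʳ _ (∈-map⁺ (tgt F) rev∈))
             , subst (_∈ endpoints) (src-rev {a} a∈E) (∈-++⁺ˡ (∈-map⁺ (src F) rev∈))
      where
      rev∈ = ∈-concatMap⁺ rightSides
               (lose (inF⇒∈ F (trans (cong (inF F) (rightCell-rev a)) l)) (∈-rightSides (rev a)))

-- Tight arcs and forced components

module _ (F : List Cell) (eq : Arc → ℤ) (skew : ∀ a → InE F a → eq (rev a) ≡ - eq a) where

  private
    t b : Arc → ℤ
    t = tF F eq
    b = bF F eq

  slack : ∀ a → (interior F a ≡ false × t a ≡ b a) ⊎ (interior F a ≡ true × t a ≡ b a + + 4)
  slack a with interior F a
  ... | true  = inj₂ (refl , widen (eq a) (sp a))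
    where
    widen : ∀ e s → e - s + + 2 ≡ e - s - + 2 + + 4
    widen = solve-∀
  ... | false = inj₁ (refl , refl)

  t≡b⇒¬interior : ∀ {a} → t a ≡ b a → interior F a ≡ false
  t≡b⇒¬interior {a} t≡b with slack a
  ... | inj₁ (boundary , _) = boundary
  ... | inj₂ (_ , t≡b+4) = ⊥-elim (shift≢ (b a) (+ 4) (λ ()) (trans (sym t≡b+4) t≡b))

  t≢b⇒t≡b+4 : ∀ {a} → t a ≢ b a → t a ≡ b a + + 4
  t≢b⇒t≡b+4 {a} t≢b with slack a
  ... | inj₁ (_ , t≡b)   = ⊥-elim (t≢b t≡b)
  ... | inj₂ (_ , t≡b+4) = t≡b+4

  t-rev : ∀ {a} → InE F a → t (rev a) ≡ - b a
  t-rev {a} a∈E rewrite interior-rev F a | skew a a∈E | sp-rev a with interior F a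
  ... | true  = flip-inner (eq a) (sp a)
    where
    flip-inner : ∀ e s → - e - - s + + 2 ≡ - (e - s - + 2)
    flip-inner = solve-∀
  ... | false = sym (ℤ.neg-distrib-+ (eq a) (sp a))

  D-rev : ∀ h {a} → InE F a → D F h (rev a) ≡ - D F h a
  D-rev h {a} a∈E =
    trans (cong₂ _-_ (cong h (tgt-rev F {a} a∈E)) (cong h (src-rev F {a} a∈E))) (swap (h (src F a)) (h (tgt F a)))
    where
    swap : ∀ x y → x - y ≡ - (y - x)
    swap = solve-∀

  Admissible : (Vertex → ℤ) → Set
  Admissible h = ∀ a → InE F a → D F h a ≡ b a ⊎ D F h a ≡ t a

  record Tight (h : Vertex → ℤ) (a : Arc) : Set where
    constructor tight
    field
      arc∈E : InE F a
      D≡t   : D F h a ≡ t a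

  ForcedEq-sym : ∀ {u v} → ForcedEq F eq u v → ForcedEq F eq v u
  ForcedEq-sym = Star.reverse λ (C , critical , u∈C , v∈C) → C , critical , v∈C , u∈C

  module _ {h : Vertex → ℤ} (admissible : Admissible h) where

    D≤t : ∀ {a} → InE F a → D F h a ℤ.≤ t a
    D≤t {a} a∈E with admissible a a∈E | slack a
    ... | inj₂ D≡t | _                = ℤ.≤-reflexive D≡t
    ... | inj₁ D≡b | inj₁ (_ , t≡b)   = ℤ.≤-reflexive (trans D≡b (sym t≡b))
    ... | inj₁ D≡b | inj₂ (_ , t≡b+4) = subst₂ ℤ._≤_ (sym D≡b) (sym t≡b+4) (ℤ.i≤i+j (b a) (+ 4))

    ¬tight⇒D≡b : ∀ {a} → InE F a → D F h a ≢ t a → D F h a ≡ b a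
    ¬tight⇒D≡b {a} a∈E ¬tight = [ id , ⊥-elim ∘ ¬tight ] (admissible a a∈E)

    ¬interior⇒tight : ∀ {a} → InE F a → interior F a ≡ false → Tight h a
    ¬interior⇒tight {a} a∈E boundary with admissible a a∈E | slack a
    ... | inj₂ D≡t | _                = tight a∈E D≡t
    ... | inj₁ D≡b | inj₁ (_ , t≡b)   = tight a∈E (trans D≡b (sym t≡b))
    ... | inj₁ _   | inj₂ (inner , _) = ⊥-elim (≡true⇒≢false inner boundary)

    RightBoundary-tight : ∀ {a} → RightBoundary F a → Tight h a
    RightBoundary-tight {a} a∂ =
      ¬interior⇒tight (RightBoundary⇒InE F a∂) (cong (_∧ inF F (rightCell a)) (RightBoundary.left∉F a∂))

  telescope-at-tgt : ∀ h a v → h v - h (src F a) ≡ D F h a + (h v - h (tgt F a))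
  telescope-at-tgt h a v = trans (sym (ℤ.+-minus-telescope (h v) (h (tgt F a)) (h (src F a))))
                             (ℤ.+-comm (h v - h (tgt F a)) (D F h a))

  tight-walk-sum : ∀ {h P} → (∀ {a} → P a → Tight h a) → ∀ {u v} (ws : Walk F P u v) →
                   gsum t (arcs F ws) ≡ h v - h u
  tight-walk-sum {h} P⇒tight {u} ε = sym (ℤ.+-inverseʳ (h u))
  tight-walk-sum {h} P⇒tight {v = v} ((a , pa , refl , refl) ◅ ws) =
    trans (cong₂ _+_ (sym (Tight.D≡t (P⇒tight pa))) (tight-walk-sum P⇒tight ws)) (sym (telescope-at-tgt h a v))

  module _ {h : Vertex → ℤ} {P : Arc → Set} (P⇒tight : ∀ {a} → P a → Tight h a) where

    simple-cycle-critical : ∀ {u} (C : Walk F P u u) → Unique (srcs F C) → 3 ℕ.≤ length (arcs F C) →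
                            Critical F eq (arcs F C)
    simple-cycle-critical {u} C@((a , _ , a← , a↦) ◅ ws) simple long =
      ((walk-chain F a a ws a↦ (sym a←) , All.map (Tight.arc∈E ∘ P⇒tight) (arcs-All F C)) , long , simple) ,
      trans (tight-walk-sum P⇒tight C) (ℤ.+-inverseʳ (h u))

    module _ (two-cycle-forced : ∀ {u v} → Link F P u v → Link F P v u → ForcedEq F eq u v) where

      simple-closed-walk-forced : ∀ {u} (C : Walk F P u u) → Unique (srcs F C) →
                                  ∀ {z} → z ∈ srcs F C → ForcedEq F eq z u
      simple-closed-walk-forced ((a , _ , refl , a↦) ◅ ε) _ _ =
        ⊥-elim (step≢ (proj₁ a) (proj₂ a) (cong proj₁ a↦))
      simple-closed-walk-forced ((_ , _ , refl , _) ◅ _ ◅ ε) _ (here refl) = ε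
      simple-closed-walk-forced (l ◅ l'@(_ , _ , refl , _) ◅ ε) _ (there (here refl)) =
        ForcedEq-sym (two-cycle-forced l l')
      simple-closed-walk-forced C@((_ , _ , refl , _) ◅ _ ◅ _ ◅ _) simple z∈C =
        (arcs F C , simple-cycle-critical C simple (ℕ.s≤s (ℕ.s≤s (ℕ.s≤s ℕ.z≤n))) , z∈C , here refl) ◅ ε

      -- Induction on the length, n being fuel: at a repeated vertex C splits into a detour and
      -- a shortcut, two shorter closed walks through that vertex.
      closed-walk-forced : ∀ n {u} (C : Walk F P u u) → length (arcs F C) ℕ.≤ n →
                           ∀ {z} → z ∈ srcs F C → ForcedEq F eq z u
      closed-walk-forced n C C≤n z∈C with simple-or-repeats F C
      ... | inj₁ simple = simple-closed-walk-forced C simple z∈C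
      closed-walk-forced zero _ C≤0 _ | inj₂ (repetition before loop-link loop _ _ refl) =
        contradiction (ℕ.<-≤-trans (nonempty F before loop-link _) C≤0) λ ()
      closed-walk-forced (suc n) {u} _ C≤n z∈C
        | inj₂ (repetition {x = x} before loop-link loop exit-link@(_ , _ , x← , _) after refl) =
        [ shortcut-forced
        , (λ z∈detour → closed-walk-forced n detour detour≤n z∈detour ◅◅ shortcut-forced x∈shortcut) ]
          (∈-detour F before detour (exit-link ◅ after) z∈C)
        where
        detour = loop-link ◅ loop
        shortcut = before ◅◅ exit-link ◅ after
        detour≤n : length (arcs F detour) ℕ.≤ n
        detour≤n = ℕ.≤-pred (ℕ.≤-trans (detour-shorter F before detour exit-link after) C≤n)
        shortcut-forced : ∀ {z} → z ∈ srcs F shortcut → ForcedEq F eq z u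
        shortcut-forced = closed-walk-forced n shortcut
          (ℕ.≤-pred (ℕ.≤-trans (shortcut-shorter F before loop-link loop (exit-link ◅ after)) C≤n))
        x∈shortcut : x ∈ srcs F shortcut
        x∈shortcut = subst (x ∈_) (sym (srcs-◅◅ F before (exit-link ◅ after)))
                           (∈-++⁺ʳ (srcs F before) (here (sym x←)))

      reachable-both-ways⇒forced : ∀ {u v} → Walk F P u v → Walk F P v u → ForcedEq F eq u v
      reachable-both-ways⇒forced forth ε = ε
      reachable-both-ways⇒forced {v = v} forth back@((_ , _ , refl , _) ◅ _) =
        ForcedEq-sym (closed-walk-forced (length (arcs F (forth ◅◅ back))) (forth ◅◅ back) ℕ.≤-refl v∈round-trip)
        where
        v∈round-trip : v ∈ srcs F (forth ◅◅ back)
        v∈round-trip = subst (v ∈_) (sym (srcs-◅◅ F forth back)) (∈-++⁺ʳ (srcs F forth) (here refl))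

  RightBoundary-forced : ∀ {h} → Admissible h → ∀ {a} → RightBoundary F a → ForcedEq F eq (src F a) (tgt F a)
  RightBoundary-forced {h} admissible {a} a∂ =
    reachable-both-ways⇒forced (RightBoundary-tight {h} admissible) (λ l l' → ⊥-elim (RightBoundary-no-two-cycle F l l'))
      ((a , a∂ , refl , refl) ◅ ε) (boundary-return F a∂)

  -- An arc that is tight together with its reverse has t = b, so it is a boundary arc.
  tight-two-cycle-forced : ∀ {h} → Admissible h → ∀ {u v} → Link F (Tight h) u v → Link F (Tight h) v u →
                           ForcedEq F eq u v
  tight-two-cycle-forced {h} admissible (a , tight a∈E Da≡t , refl , refl) (a' , tight _ Da'≡t , a'← , a'↦)
    with ¬interior⇒RightBoundary F a∈E (t≡b⇒¬interior (trans (sym Da≡t) D≡b))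
    where
    a'≡rev : a' ≡ rev a
    a'≡rev = returning-arc≡rev a a' (cong proj₁ a'←) (cong proj₁ a'↦)
    D≡b : D F h a ≡ b a
    D≡b = ℤ.neg-injective (begin
      - D F h a                  ≡⟨ D-rev h a∈E ⟨
      D F h (rev a)              ≡⟨ cong₂ _-_ (cong h (tgt-rev F {a} a∈E)) (cong h (src-rev F {a} a∈E)) ⟩
      h (src F a) - h (tgt F a)  ≡⟨ cong₂ _-_ (cong h a'↦) (cong h a'←) ⟨
      D F h a'                   ≡⟨ Da'≡t ⟩
      t a'                       ≡⟨ cong t a'≡rev ⟩
      t (rev a)                  ≡⟨ t-rev a∈E ⟩
      - b a                      ∎)
      where open ≡-Reasoning
  ... | inj₁ a∂   = RightBoundary-forced {h} admissible a∂
  ... | inj₂ rev∂ = ForcedEq-sym (subst₂ (ForcedEq F eq) (src-rev F {a} a∈E) (tgt-rev F {a} a∈E)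
                                         (RightBoundary-forced {h} admissible rev∂))

  tight-walks⇒forced : ∀ {h} → Admissible h → ∀ {u v} → Walk F (Tight h) u v → Walk F (Tight h) v u →
                       ForcedEq F eq u v
  tight-walks⇒forced {h} admissible = reachable-both-ways⇒forced id (tight-two-cycle-forced {h} admissible)

  -- Local moves on height functions

  lower : (Vertex → Bool) → (Vertex → ℤ) → Vertex → ℤ
  lower marked g u = if marked u then g u - + 4 else g u

  lower-in : ∀ marked g {u} → marked u ≡ true → lower marked g u ≡ g u - + 4
  lower-in marked g u∈marked rewrite u∈marked = refl

  lower-out : ∀ marked g {u} → marked u ≡ false → lower marked g u ≡ g u
  lower-out marked g u∉marked rewrite u∉marked = refl

  lower-admissible : ∀ {g} marked → Admissible g →
                     (∀ {a} → InE F a → D F g a ≡ t a → marked (src F a) ≡ true → marked (tgt F a) ≡ true) →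
                     Admissible (lower marked g)
  lower-admissible {g} marked admissible closed a a∈E
    with true⊎false (marked (src F a)) | true⊎false (marked (tgt F a))
  ... | inj₁ src∈marked | inj₁ tgt∈marked = Sum.map (trans same) (trans same) (admissible a a∈E)
    where
    cancel : ∀ x y → (y - + 4) - (x - + 4) ≡ y - x
    cancel = solve-∀
    same : D F (lower marked g) a ≡ D F g a
    same = trans (cong₂ _-_ (lower-in marked g tgt∈marked) (lower-in marked g src∈marked))
                 (cancel (g (src F a)) (g (tgt F a)))
  ... | inj₂ src∉marked | inj₂ tgt∉marked = Sum.map (trans same) (trans same) (admissible a a∈E)
    where
    same : D F (lower marked g) a ≡ D F g a
    same = cong₂ _-_ (lower-out marked g tgt∉marked) (lower-out marked g src∉marked)
  ... | inj₁ src∈marked | inj₂ tgt∉marked = inj₂ (begin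
    D F (lower marked g) a              ≡⟨ cong₂ _-_ (lower-out marked g tgt∉marked) (lower-in marked g src∈marked) ⟩
    g (tgt F a) - (g (src F a) - + 4) ≡⟨ rearrange (g (src F a)) (g (tgt F a)) ⟩
    D F g a + + 4                  ≡⟨ cong (_+ + 4) D≡b ⟩
    b a + + 4                      ≡⟨ t≢b⇒t≡b+4 (λ t≡b → ¬tight (trans D≡b (sym t≡b))) ⟨
    t a                            ∎)
    where
    open ≡-Reasoning
    rearrange : ∀ x y → y - (x - + 4) ≡ y - x + + 4
    rearrange = solve-∀
    ¬tight : D F g a ≢ t a
    ¬tight D≡t = ≡true⇒≢false (closed a∈E D≡t src∈marked) tgt∉marked
    D≡b : D F g a ≡ b a
    D≡b = ¬tight⇒D≡b {g} admissible {a} a∈E ¬tight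
  ... | inj₂ src∉marked | inj₁ tgt∈marked = inj₁ (begin
    D F (lower marked g) a              ≡⟨ cong₂ _-_ (lower-in marked g tgt∈marked) (lower-out marked g src∉marked) ⟩
    (g (tgt F a) - + 4) - g (src F a) ≡⟨ rearrange (g (src F a)) (g (tgt F a)) ⟩
    D F g a - + 4                  ≡⟨ cong (_- + 4) D≡t ⟩
    t a - + 4                      ≡⟨ cong (_- + 4) (t≢b⇒t≡b+4 (λ t≡b → ¬D≡b (trans D≡t t≡b))) ⟩
    b a + + 4 - + 4                ≡⟨ x+4-4≡x (b a) ⟩
    b a                            ∎)
    where
    open ≡-Reasoning
    rearrange : ∀ x y → (y - + 4) - x ≡ y - x - + 4
    rearrange = solve-∀
    ¬D≡b : D F g a ≢ b a
    ¬D≡b D≡b = ≡true⇒≢false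
      (closed {rev a} (InE-rev F {a} a∈E) rev-tight (subst (λ v → marked v ≡ true) (sym (src-rev F {a} a∈E)) tgt∈marked))
      (subst (λ v → marked v ≡ false) (sym (tgt-rev F {a} a∈E)) src∉marked)
      where
      rev-tight : D F g (rev a) ≡ t (rev a)
      rev-tight = trans (D-rev g a∈E) (trans (cong -_ D≡b) (sym (t-rev a∈E)))
    D≡t : D F g a ≡ t a
    D≡t = [ ⊥-elim ∘ ¬D≡b , id ] (admissible a a∈E)

  D-shift : ∀ g c a → D F (λ u → g u + c) a ≡ D F g a
  D-shift g c a = cancel (g (src F a)) (g (tgt F a)) c
    where
    cancel : ∀ x y c → (y + c) - (x + c) ≡ y - x
    cancel = solve-∀

  shift-admissible : ∀ {g} c → Admissible g → Admissible (λ u → g u + c)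
  shift-admissible {g} c admissible a a∈E = Sum.map (trans (D-shift g c a)) (trans (D-shift g c a)) (admissible a a∈E)

  tight-walk-slack : ∀ {g h} → Admissible h → ∀ {u v} → Walk F (Tight g) u v → h v - h u ℤ.≤ g v - g u
  tight-walk-slack {g} {h} admissible {u} ε =
    ℤ.≤-reflexive (trans (ℤ.+-inverseʳ (h u)) (sym (ℤ.+-inverseʳ (g u))))
  tight-walk-slack {g} {h} admissible {v = v} ((a , tight a∈E Dg≡t , refl , refl) ◅ ws) = begin
    h v - h (src F a)               ≡⟨ telescope-at-tgt h a v ⟩
    D F h a + (h v - h (tgt F a))   ≤⟨ ℤ.+-mono-≤ (D≤t {h} admissible {a} a∈E) (tight-walk-slack {g} {h} admissible ws) ⟩
    t a + (g v - g (tgt F a))       ≡⟨ cong (_+ (g v - g (tgt F a))) Dg≡t ⟨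
    D F g a + (g v - g (tgt F a))   ≡⟨ telescope-at-tgt g a v ⟨
    g v - g (src F a)               ∎
    where open ℤ.≤-Reasoning

  tight-transfer : ∀ {g h} → Admissible h → ∀ {u v} (ws : Walk F (Tight g) u v) →
                   h v - h u ≡ g v - g u → Walk F (Tight h) u v
  tight-transfer admissible ε _ = ε
  tight-transfer {g} {h} admissible {v = v} ((a , tight a∈E Dg≡t , refl , refl) ◅ ws) same =
    (a , tight a∈E (proj₁ both-tight) , refl , refl) ◅ tight-transfer {g} {h} admissible ws (proj₂ both-tight)
    where
    open ≡-Reasoning
    both-tight : D F h a ≡ t a × h v - h (tgt F a) ≡ g v - g (tgt F a)
    both-tight = +-tight (D≤t {h} admissible {a} a∈E) (tight-walk-slack {g} {h} admissible ws) (begin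
      D F h a + (h v - h (tgt F a))   ≡⟨ telescope-at-tgt h a v ⟨
      h v - h (src F a)               ≡⟨ same ⟩
      g v - g (src F a)               ≡⟨ telescope-at-tgt g a v ⟩
      D F g a + (g v - g (tgt F a))   ≡⟨ cong (_+ (g v - g (tgt F a))) Dg≡t ⟩
      t a + (g v - g (tgt F a))       ∎)

  -- Tight reachability is not decidable constructively, but as the goal is a negation it
  -- may be decided on the finitely many vertices that matter.
  ¬¬tight-walk-to-base : ∀ {w0 h hmin} → IsHeight F eq w0 h → (∀ h' → IsHeight F eq w0 h' → hmin ≤H[ F ] h') →
                         ∀ {v} → InV F v → hmin v ≡ h v → ¬ ¬ Walk F (Tight h) v w0
  ¬¬tight-walk-to-base {w0} {h} {hmin} (h-w0 , admissible) minimal {v} v∈V hmin≡h ¬walk =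
    ¬¬-reflects _≟ᵥ_ (Walk F (Tight h) v) (v ∷ w0 ∷ endpoints F) refute
    where
    refute : (Σ (Vertex → Bool) λ reached →
               ∀ {x} → x ∈ v ∷ w0 ∷ endpoints F → Reflects (Walk F (Tight h) v x) (reached x)) → ⊥
    refute (reached , reflects) = x≰x-4 (hmin v) (begin
      hmin v             ≤⟨ minimal (lower reached h) (lowered-w0 , lowered-admissible) v v∈V ⟩
      lower reached h v  ≡⟨ lower-in reached h (det (reflects (here refl)) (ofʸ ε)) ⟩
      h v - + 4          ≡⟨ cong (_- + 4) hmin≡h ⟨
      hmin v - + 4       ∎)
      where
      open ℤ.≤-Reasoning
      lowered-w0 : lower reached h w0 ≡ + 0
      lowered-w0 = trans (lower-out reached h (det (reflects (there (here refl))) (ofⁿ ¬walk))) h-w0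
      closed : ∀ {a} → InE F a → D F h a ≡ t a → reached (src F a) ≡ true → reached (tgt F a) ≡ true
      closed {a} a∈E D≡t src-reached =
        det (reflects (there (there (proj₂ (InE⇒endpoints F {a} a∈E)))))
            (ofʸ (walk-to-src ◅◅ (a , tight a∈E D≡t , refl , refl) ◅ ε))
        where
        walk-to-src : Walk F (Tight h) v (src F a)
        walk-to-src = invert (subst (Reflects _) src-reached (reflects (there (there (proj₁ (InE⇒endpoints F {a} a∈E))))))
      lowered-admissible : Admissible (lower reached h)
      lowered-admissible = lower-admissible {h} reached admissible closed

  -- Raising h by 4 on the vertices that tightly reach v is lowering h + 4 off them.
  ¬¬tight-walk-from-base : ∀ {w0 h hmax} → IsHeight F eq w0 h → (∀ h' → IsHeight F eq w0 h' → h' ≤H[ F ] hmax) →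
                           ∀ {v} → InV F v → h v ≡ hmax v → ¬ ¬ Walk F (Tight h) w0 v
  ¬¬tight-walk-from-base {w0} {h} {hmax} (h-w0 , admissible) maximal {v} v∈V h≡hmax ¬walk =
    ¬¬-reflects _≟ᵥ_ (λ x → Walk F (Tight h) x v) (v ∷ w0 ∷ endpoints F) refute
    where
    refute : (Σ (Vertex → Bool) λ reaches →
               ∀ {x} → x ∈ v ∷ w0 ∷ endpoints F → Reflects (Walk F (Tight h) x v) (reaches x)) → ⊥
    refute (reaches , reflects) = x+4≰x (h v) (begin
      h v + + 4           ≡⟨ lower-out (not ∘ reaches) raised (cong not (det (reflects (here refl)) (ofʸ ε))) ⟨
      candidate v         ≤⟨ maximal candidate (candidate-w0 , candidate-admissible) v v∈V ⟩
      hmax v              ≡⟨ h≡hmax ⟨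
      h v                 ∎)
      where
      open ℤ.≤-Reasoning
      raised : Vertex → ℤ
      raised u = h u + + 4
      candidate : Vertex → ℤ
      candidate = lower (not ∘ reaches) raised
      candidate-w0 : candidate w0 ≡ + 0
      candidate-w0 = trans (lower-in (not ∘ reaches) raised (cong not (det (reflects (there (here refl))) (ofⁿ ¬walk))))
                           (trans (x+4-4≡x (h w0)) h-w0)
      closed : ∀ {a} → InE F a → D F raised a ≡ t a → not (reaches (src F a)) ≡ true → not (reaches (tgt F a)) ≡ true
      closed {a} a∈E D≡t src-unreached = cong not (det (reflects (there (there (proj₂ (InE⇒endpoints F {a} a∈E)))))
        (ofⁿ λ walk → ≡true⇒≢false
          (det (reflects (there (there (proj₁ (InE⇒endpoints F {a} a∈E)))))
               (ofʸ ((a , tight a∈E (trans (sym (D-shift h (+ 4) a)) D≡t) , refl , refl) ◅ walk)))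
          (not-injective {y = false} src-unreached)))
      candidate-admissible : Admissible candidate
      candidate-admissible = lower-admissible {raised} (not ∘ reaches) (shift-admissible {h} (+ 4) admissible) closed

mainTheorem11 : (F : List Cell) → Figure F → Tileable F →
    (eq : Arc → ℤ) → Equilibrium F eq →
    (w0 : Vertex) → OnBoundaryHinf F w0 →
    (hmin hmax : Vertex → ℤ) →
    IsHeight F eq w0 hmin → IsHeight F eq w0 hmax →
    (∀ h → IsHeight F eq w0 h → hmin ≤H[ F ] h) →
    (∀ h → IsHeight F eq w0 h → h ≤H[ F ] hmax) →
    ∀ v → InV F v → ¬ ForcedEq F eq v w0 → hmin v ≢ hmax v
mainTheorem11 F _ _ eq (skew , _) w0 _ hmin hmax hmin-height hmax-height minimal maximal v v∈V v≁w0 hmin≡hmax =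
  ¬¬tight-walk-to-base F eq skew hmax-height minimal v∈V hmin≡hmax λ down →
  ¬¬tight-walk-from-base F eq skew hmin-height maximal v∈V hmin≡hmax λ up →
  v≁w0 (tight-walks⇒forced F eq skew {hmax} (proj₂ hmax-height) down
          (tight-transfer F eq skew {hmin} {hmax} (proj₂ hmax-height) up potentials))
  where
  potentials : hmax v - hmax w0 ≡ hmin v - hmin w0
  potentials = cong₂ _-_ (sym hmin≡hmax) (trans (proj₁ hmax-height) (sym (proj₁ hmin-height)))
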